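{- Let $G$ be a connected reduced graph, and let $v\in V(G)$. Then in the standard decomposition of $G$ from $v$, $|S|\ge2$.
   Context: $\Gamma_G(v)$ is the neighbourhood of $v$, $\Gamma_G(X)=\bigcup_{u\in X}\Gamma_G(u)\setminus X$, and $\Gamma^2_G(v)$ is the set of vertices at distance exactly $2$ from $v$. A graph is a near-forest if it has no vertices or contains a vertex $u$ such that deleting $u$ and its neighbours leaves a forest. $G$ is reduced if every non-empty $X\subseteq V(G)$ such that $G[X]$ is a near-forest satisfies $|\Gamma_G(X)|\ge2$. In the standard decomposition of $G$ from $v$, let $H_1,\dots,H_k$ be the non-tree components of $G-v-\Gamma_G(v)$, and $S=(V(H_1)\cup\dots\cup V(H_k))\cap\Gamma^2_G(v)$. -}

module Defs where

open import Data.Nat using (ℕ; _≤_)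
open import Data.Bool using (Bool; T)
open import Data.Fin using (Fin)
open import Data.Fin.Subset using (Subset; _∈_; _∉_; Nonempty)
open import Data.List using (List; []; _∷_; length; _∷ʳ_)
open import Data.List.Relation.Unary.All using (All)
open import Data.List.Relation.Unary.Unique.Propositional using (Unique)
open import Data.Product using (Σ; ∃; ∃-syntax; _×_; _,_)
open import Data.Unit using (⊤)
open import Data.Empty using (⊥)
open import Data.Sum using (_⊎_)
open import Relation.Nullary using (¬_)
open import Relation.Binary.PropositionalEquality using (_≡_; _≢_)

record Graph (n : ℕ) : Set where
  field
    E     : Fin n → Fin n → Bool
    sym   : ∀ i j → E i j ≡ E j i
    irrefl : ∀ i → E i i ≡ Data.Bool.false

module _ {n : ℕ} (G : Graph n) where
  open Graph G

  Adj : Fin n → Fin n → Set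
  Adj i j = T (E i j)

  -- vertex sets as predicates (used for induced subgraphs G[P])
  VSet : Set₁
  VSet = Fin n → Set

  Chain : List (Fin n) → Set
  Chain []           = ⊤
  Chain (x ∷ [])     = ⊤
  Chain (x ∷ y ∷ zs) = Adj x y × Chain (y ∷ zs)

  record Cycle (P : VSet) : Set where
    constructor cycle
    field
      start : Fin n
      rest  : List (Fin n)
      long  : 2 ≤ length rest
      inP   : All P (start ∷ rest)
      uniq  : Unique (start ∷ rest)
      chain : Chain (start ∷ rest ∷ʳ start)

  Forest : VSet → Set
  Forest P = ¬ Cycle P

  data Walk (P : VSet) : Fin n → Fin n → Set where
    stay : ∀ {u} → P u → Walk P u u
    step : ∀ {u x w} → P u → Adj u x → Walk P x w → Walk P u w

  Connected : Set
  Connected = ∀ u w → Walk (λ _ → ⊤) u w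

  NearForest : Subset n → Set
  NearForest X = (∀ u → u ∉ X) ⊎ (∃[ u ] (u ∈ X × Forest (λ w → w ∈ X × w ≢ u × ¬ Adj u w)))

  Γ : Subset n → VSet
  Γ X w = w ∉ X × ∃[ u ] (u ∈ X × Adj u w)

  AtLeastTwo : VSet → Set
  AtLeastTwo P = ∃[ a ] ∃[ b ] (a ≢ b × P a × P b)

  Reduced : Set
  Reduced = ∀ (X : Subset n) → Nonempty X → NearForest X → AtLeastTwo (Γ X)

  Rest : Fin n → VSet
  Rest v w = w ≢ v × ¬ Adj v w

  Γ² : Fin n → VSet
  Γ² v w = w ≢ v × ¬ Adj v w × ∃[ x ] (Adj v x × Adj x w)

  -- w lies in a non-tree component of G - v - Γ_G(v), i.e. the component
  -- (of G - v - Γ_G(v)) containing w contains a cycle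
  InNonTreeComp : Fin n → VSet
  InNonTreeComp v w =
    Rest v w × Σ (Cycle (Rest v)) (λ c → Walk (Rest v) w (Cycle.start c))

  S : Fin n → VSet
  S v w = InNonTreeComp v w × Γ² v w

-- Let X be the set of vertices outside the non-tree components H₁, …, H_k of
-- G - v - Γ(v). Deleting v and its neighbours from G[X] leaves exactly the tree
-- components, so G[X] is a near-forest containing v, and reducedness yields two
-- vertices in Γ(X). Each of them lies in some Hᵢ and has a neighbour u ∈ X. Since
-- components of G - v - Γ(v) are closed under adjacency, u is neither v nor in a
-- tree component, so u ∈ Γ(v); hence the vertex is in Γ²(v) ∩ Hᵢ ⊆ S.
-- Constructively X must be a decidable set: membership in the Hᵢ is decided by
-- enumerating the candidate cycles (at most n vertices) and by depth-first search.
module Submission where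

open import Data.Nat using (ℕ; zero; suc; _≤_; _≤?_; s≤s)
open import Data.Nat.Properties using (≤-refl; ≤-trans; ≤-pred; <⇒≤)
open import Data.Fin using (Fin; _≟_)
import Data.Fin.Properties as Fin
open import Data.Fin.Subset using (Subset; _∈_; _∉_)
open import Data.Bool using (true)
open import Data.Bool.Properties using (T?)
open import Data.Empty using (⊥; ⊥-elim)
open import Data.List using (List; []; _∷_; [_]; length; _∷ʳ_; filter; allFin; lookup; cartesianProductWith)
open import Data.List.Properties using (filter-notAll)
open import Data.List.Relation.Unary.Any using (Any; here; there; satisfied)
import Data.List.Relation.Unary.Any as Any
open import Data.List.Relation.Unary.Any.Properties using (¬Any[])
open import Data.List.Relation.Unary.All using (All)
open import Data.List.Relation.Unary.AllPairs using (_∷_)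
import Data.List.Relation.Unary.All as All
open import Data.List.Relation.Unary.Unique.Propositional using (Unique)
import Data.List.Relation.Unary.Unique.DecPropositional as Unique
open import Data.List.Membership.Propositional using (lose) renaming (_∈_ to _∈ₗ_)
open import Data.List.Membership.Propositional.Properties
  using (∈-filter⁺; ∈-filter⁻; ∈-allFin; ∈-lookup; ∈-cartesianProductWith⁺)
open import Data.Vec using (tabulate)
open import Data.Vec.Properties using (lookup∘tabulate; []=⇒lookup; lookup⇒[]=)
open import Data.Product using (Σ; ∃-syntax; _×_; _,_; proj₁; proj₂)
open import Data.Unit using (tt)
open import Data.Sum using (_⊎_; inj₁; inj₂)
open import Function using (_∘_)
open import Relation.Nullary using (¬_; Dec; yes; no; ¬?; _×-dec_; does)
open import Relation.Nullary.Decidable using (map′; decidable-stable)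
open import Relation.Unary using (Decidable; _⊆_)
open import Relation.Binary.PropositionalEquality using (_≡_; _≢_; refl; sym; trans; cong)
open import Defs

module _ {n : ℕ} where

  fromDec : {P : Fin n → Set} → Decidable P → Subset n
  fromDec P? = tabulate (does ∘ P?)

  module _ {P : Fin n → Set} (P? : Decidable P) {w : Fin n} where

    ∈-fromDec⁻ : w ∈ fromDec P? → P w
    ∈-fromDec⁻ w∈ with P? w | trans (sym (lookup∘tabulate (does ∘ P?) w)) ([]=⇒lookup w∈)
    ... | yes p | _ = p
    ... | no _  | ()

    ∈-fromDec⁺ : P w → w ∈ fromDec P?
    ∈-fromDec⁺ p = lookup⇒[]= w (fromDec P?) (trans (lookup∘tabulate (does ∘ P?) w) (true-if p))
      where
        true-if : P w → does (P? w) ≡ true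
        true-if p with P? w
        ... | yes _ = refl
        ... | no ¬p = ⊥-elim (¬p p)

  ∉-fromDec⁻ : {P : Fin n → Set} (P? : Decidable P) {w : Fin n} → w ∉ fromDec (¬? ∘ P?) → P w
  ∉-fromDec⁻ P? {w} w∉ = decidable-stable (P? w) (w∉ ∘ ∈-fromDec⁺ (¬? ∘ P?))

  lookup-injective : ∀ {xs : List (Fin n)} → Unique xs → ∀ i j → lookup xs i ≡ lookup xs j → i ≡ j
  lookup-injective {_ ∷ _} _          Fin.zero    Fin.zero    _  = refl
  lookup-injective {_ ∷ _} (x∉ ∷ _)   Fin.zero    (Fin.suc j) eq = ⊥-elim (All.lookup x∉ (∈-lookup j) eq)
  lookup-injective {_ ∷ _} (x∉ ∷ _)   (Fin.suc i) Fin.zero    eq = ⊥-elim (All.lookup x∉ (∈-lookup i) (sym eq))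
  lookup-injective {_ ∷ _} (_ ∷ uniq) (Fin.suc i) (Fin.suc j) eq = cong Fin.suc (lookup-injective uniq i j eq)

  unique⇒length≤ : ∀ {xs : List (Fin n)} → Unique xs → length xs ≤ n
  unique⇒length≤ uniq = Fin.injective⇒≤ (λ {i} {j} → lookup-injective uniq i j)

  listsOfLength≤ : ℕ → List (List (Fin n))
  listsOfLength≤ zero    = [ [] ]
  listsOfLength≤ (suc k) = [] ∷ cartesianProductWith _∷_ (allFin n) (listsOfLength≤ k)

  ∈-listsOfLength≤ : ∀ k (xs : List (Fin n)) → length xs ≤ k → xs ∈ₗ listsOfLength≤ k
  ∈-listsOfLength≤ zero    []       _        = here refl
  ∈-listsOfLength≤ (suc k) []       _        = here refl
  ∈-listsOfLength≤ (suc k) (x ∷ xs) (s≤s xs≤k) =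
    there (∈-cartesianProductWith⁺ _∷_ (∈-allFin x) (∈-listsOfLength≤ k xs xs≤k))

module _ {n : ℕ} (G : Graph n) where

  adj? : ∀ u w → Dec (Adj G u w)
  adj? u w = T? (Graph.E G u w)

  walk-head : ∀ {P u w} → Walk G P u w → P u
  walk-head (stay p)     = p
  walk-head (step p _ _) = p

  walk-map : ∀ {P Q} → P ⊆ Q → ∀ {u w} → Walk G P u w → Walk G Q u w
  walk-map P⊆Q (stay p)     = stay (P⊆Q p)
  walk-map P⊆Q (step p a W) = step (P⊆Q p) a (walk-map P⊆Q W)

  cycle-map : ∀ {P Q} → P ⊆ Q → Cycle G P → Cycle G Q
  cycle-map P⊆Q (cycle s r long inP uniq chain) = cycle s r long (All.map P⊆Q inP) uniq chain

  Avoiding : VSet G → Fin n → VSet G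
  Avoiding P x y = P y × y ≢ x

  walk-lastExit : ∀ {P a w} (x : Fin n) → Walk G P a w →
                  Walk G (Avoiding P x) a w ⊎ (w ≡ x ⊎ ∃[ y ] (Adj G x y × Walk G (Avoiding P x) y w))
  walk-lastExit {a = a} x (stay p) with a ≟ x
  ... | yes a≡x = inj₂ (inj₁ a≡x)
  ... | no  a≢x = inj₁ (stay (p , a≢x))
  walk-lastExit {a = a} x (step {x = y} p a~y W) with walk-lastExit x W | a ≟ x
  ... | inj₂ later | _        = inj₂ later
  ... | inj₁ W′    | yes refl = inj₂ (inj₂ (y , a~y , W′))
  ... | inj₁ W′    | no  a≢x  = inj₁ (step (p , a≢x) a~y W′)

  walkFrom-lastExit : ∀ {P u w} → Walk G P u w → u ≢ w → ∃[ y ] (Adj G u y × Walk G (Avoiding P u) y w)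
  walkFrom-lastExit {u = u} W u≢w with walk-lastExit u W
  ... | inj₁ W′            = ⊥-elim (proj₂ (walk-head W′) refl)
  ... | inj₂ (inj₁ w≡u)    = ⊥-elim (u≢w (sym w≡u))
  ... | inj₂ (inj₂ exit)   = exit

  -- Depth-first search: the fuel bounds the number of allowed vertices, and
  -- each step removes the current vertex from them.
  walkWithin? : ∀ (L : List (Fin n)) u w → Dec (Walk G (_∈ₗ L) u w)
  walkWithin? L = search (length L) L ≤-refl
    where
      search : ∀ k (L : List (Fin n)) → length L ≤ k → ∀ u w → Dec (Walk G (_∈ₗ L) u w)
      search zero [] _ u w = no (¬Any[] ∘ walk-head)
      search (suc k) L L≤k u w with Any.any? (u ≟_) L | u ≟ w
      ... | no  u∉L | _        = no (u∉L ∘ walk-head)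
      ... | yes u∈L | yes refl = yes (stay u∈L)
      ... | yes u∈L | no  u≢w  =
        map′ (λ (y , u~y , W) → step u∈L u~y (walk-map (proj₁ ∘ ∈-filter⁻ ≢u?) W))
             (λ W → let y , u~y , W′ = walkFrom-lastExit W u≢w
                    in y , u~y , walk-map (λ (y∈L , y≢u) → ∈-filter⁺ ≢u? y∈L y≢u) W′)
             (Fin.any? λ y → adj? u y ×-dec search k L′ L′≤k y w)
        where
          ≢u? : Decidable (_≢ u)
          ≢u? y = ¬? (y ≟ u)

          L′ : List (Fin n)
          L′ = filter ≢u? L

          L′≤k : length L′ ≤ k
          L′≤k = ≤-pred (≤-trans (filter-notAll ≢u? L (Any.map (λ u≡y u≢y → u≢y (sym u≡y)) u∈L)) L≤k)

  walk? : ∀ {P} → Decidable P → ∀ u w → Dec (Walk G P u w)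
  walk? P? u w =
    map′ (walk-map (proj₂ ∘ ∈-filter⁻ P? {xs = allFin n})) (walk-map (∈-filter⁺ P? (∈-allFin _)))
         (walkWithin? (filter P? (allFin n)) u w)

  ReachesCycle : VSet G → Fin n → Set
  ReachesCycle P w = Σ (Cycle G P) (λ c → Walk G P w (Cycle.start c))

  IsCycleFrom : VSet G → Fin n → List (Fin n) → Set
  IsCycleFrom P s r = 2 ≤ length r × All P (s ∷ r) × Unique (s ∷ r) × Chain G (s ∷ r ∷ʳ s)

  chain? : ∀ xs → Dec (Chain G xs)
  chain? []           = yes tt
  chain? (_ ∷ [])     = yes tt
  chain? (x ∷ y ∷ zs) = adj? x y ×-dec chain? (y ∷ zs)

  isCycleFrom? : ∀ {P} → Decidable P → ∀ s r → Dec (IsCycleFrom P s r)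
  isCycleFrom? P? s r =
    2 ≤? length r ×-dec All.all? P? (s ∷ r) ×-dec Unique.unique? _≟_ (s ∷ r) ×-dec chain? (s ∷ r ∷ʳ s)

  -- A cycle has at most n vertices, so its list of vertices is among finitely many candidates.
  reachesCycle? : ∀ {P} → Decidable P → Decidable (ReachesCycle P)
  reachesCycle? {P} P? w =
    map′ fromCandidate toCandidate
         (Fin.any? λ s → walk? P? w s ×-dec Any.any? (isCycleFrom? P? s) (listsOfLength≤ n))
    where
      Candidate : Fin n → Set
      Candidate s = Walk G P w s × Any (IsCycleFrom P s) (listsOfLength≤ n)

      fromCandidate : ∃[ s ] Candidate s → ReachesCycle P w
      fromCandidate (s , W , isCycle) =
        let r , (long , inP , uniq , chain) = satisfied isCycle in cycle s r long inP uniq chain , W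

      toCandidate : ReachesCycle P w → ∃[ s ] Candidate s
      toCandidate (cycle s r long inP uniq chain , W) =
        s , W , lose (∈-listsOfLength≤ n r (<⇒≤ (unique⇒length≤ uniq))) (long , inP , uniq , chain)

module _ {n : ℕ} (G : Graph n) (v : Fin n) where

  rest? : Decidable (Rest G v)
  rest? w = ¬? (w ≟ v) ×-dec ¬? (adj? G v w)

  inNonTreeComp? : Decidable (InNonTreeComp G v)
  inNonTreeComp? w = rest? w ×-dec reachesCycle? G rest? w

  cycle-start-inNonTreeComp : (c : Cycle G (Rest G v)) → InNonTreeComp G v (Cycle.start c)
  cycle-start-inNonTreeComp c = All.head (Cycle.inP c) , c , stay (All.head (Cycle.inP c))

  inNonTreeComp-step : ∀ {u w} → Rest G v u → Adj G u w → InNonTreeComp G v w → InNonTreeComp G v u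
  inNonTreeComp-step ru u~w (_ , c , W) = ru , c , step ru u~w W

  X : Subset n
  X = fromDec (¬? ∘ inNonTreeComp?)

  v∈X : v ∈ X
  v∈X = ∈-fromDec⁺ (¬? ∘ inNonTreeComp?) (λ ((v≢v , _) , _) → v≢v refl)

  X-nearForest : NearForest G X
  X-nearForest = inj₂ (v , v∈X , λ c →
    let c′ = cycle-map G (λ (_ , w≢v , ¬v~w) → w≢v , ¬v~w) c
    in ∈-fromDec⁻ (¬? ∘ inNonTreeComp?) (proj₁ (All.head (Cycle.inP c)))
                  (cycle-start-inNonTreeComp c′))

  X-neighbour-of-nonTreeComp⇒adj-v : ∀ {u w} → u ∈ X → Adj G u w → InNonTreeComp G v w → Adj G v u
  X-neighbour-of-nonTreeComp⇒adj-v {u} u∈X u~w w∈H =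
    decidable-stable (adj? G v u) (impossible (u ≟ v))
    where
      impossible : Dec (u ≡ v) → ¬ Adj G v u → ⊥
      impossible (yes refl) _    = proj₂ (proj₁ w∈H) u~w
      impossible (no  u≢v) ¬v~u =
        ∈-fromDec⁻ (¬? ∘ inNonTreeComp?) u∈X (inNonTreeComp-step (u≢v , ¬v~u) u~w w∈H)

  Γ[X]⊆S : Γ G X ⊆ S G v
  Γ[X]⊆S (w∉X , u , u∈X , u~w) =
    let w∈H = ∉-fromDec⁻ inNonTreeComp? w∉X
        (w≢v , ¬v~w) = proj₁ w∈H
    in w∈H , w≢v , ¬v~w , u , X-neighbour-of-nonTreeComp⇒adj-v u∈X u~w w∈H , u~w

lemma36 : ∀ (n : ℕ) (G : Graph n) → Connected G → Reduced G → (v : Fin n) → AtLeastTwo G (S G v)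
lemma36 n G _ reduced v =
  let a , b , a≢b , a∈Γ , b∈Γ = reduced (X G v) (v , v∈X G v) (X-nearForest G v)
  in a , b , a≢b , Γ[X]⊆S G v a∈Γ , Γ[X]⊆S G v b∈Γ
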